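{- Let $a,b,x,y$ be positive integers such that (i) $a\equiv 2\pmod 4$ and $x\equiv 1\pmod 4$; (ii) $y>b\ge 2$; (iii) $x\ge a+3$. Then $$\big[2a+(b-2)(a+2)\big]\big[3(x-a+3)+(y-b-2)(x-a+5)\big]\ \ge\ 3(x+1)+(y-3)(x+3).$$ -}

module Defs where

open import Data.Integer using (ℤ; +_; _-_)
open import Data.Integer.Divisibility using (_∣_)

_≡ℤ_mod4 : ℤ → ℤ → Set
n ≡ℤ r mod4 = + 4 ∣ (n - r)

{-# OPTIONS --safe #-}
module Submission where

-- With p = a - 1, q = x - a - 3, B = b - 2 and Y = y - b - 1, all non-negative, the left-hand
-- side minus the right-hand side is a polynomial in p, q, B, Y with non-negative coefficients.

open import Defs
open import Data.Nat using (ℕ; z≤n)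
open import Data.Integer using (ℤ; +_; _+_; _-_; _*_; _≤_; _<_; _≥_; 0ℤ; +≤+; nonNegative)
open import Data.Integer.Properties
  using (+-mono-≤; *-monoˡ-≤-nonNeg; *-zeroʳ; ≤-trans; ≤-reflexive; i≤i+j; i≤j⇒0≤j-i; i<j⇒suc[i]≤j)
open import Data.Integer.Tactic.RingSolver using (solve-∀)
open import Relation.Binary.PropositionalEquality using (_≡_; sym; subst)

0≤+ : ∀ n → 0ℤ ≤ + n
0≤+ n = +≤+ z≤n

0≤i+j : ∀ {i j} → 0ℤ ≤ i → 0ℤ ≤ j → 0ℤ ≤ i + j
0≤i+j = +-mono-≤

0≤i*j : ∀ {i j} → 0ℤ ≤ i → 0ℤ ≤ j → 0ℤ ≤ i * j
0≤i*j {i} 0≤i 0≤j = subst (_≤ i * _) (*-zeroʳ i) (*-monoˡ-≤-nonNeg i ⦃ nonNegative 0≤i ⦄ 0≤j)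

multiaffine : ℕ → ℕ → ℕ → ℕ → ℤ → ℤ → ℤ
multiaffine k l m n q y = + k + + l * q + + m * y + + n * (q * y)

-- Inlined, as is excess below, because the ring solver does not unfold definitions.
{-# INLINE multiaffine #-}

multiaffine-nonNeg : ∀ k l m n {q y} → 0ℤ ≤ q → 0ℤ ≤ y → 0ℤ ≤ multiaffine k l m n q y
multiaffine-nonNeg k l m n 0≤q 0≤y =
  0≤i+j (0≤i+j (0≤i+j (0≤+ k) (0≤i*j (0≤+ l) 0≤q)) (0≤i*j (0≤+ m) 0≤y))
        (0≤i*j (0≤+ n) (0≤i*j 0≤q 0≤y))

excess : ℤ → ℤ → ℤ → ℤ → ℤ
excess p q B Y = multiaffine 5 1 9 1 q Y + p * multiaffine 17 4 15 2 q Y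
               + B * multiaffine 23 5 24 3 q Y + B * p * multiaffine 9 2 8 1 q Y

{-# INLINE excess #-}

excess-nonNeg : ∀ {p q B Y} → 0ℤ ≤ p → 0ℤ ≤ q → 0ℤ ≤ B → 0ℤ ≤ Y → 0ℤ ≤ excess p q B Y
excess-nonNeg {q = q} {Y = Y} 0≤p 0≤q 0≤B 0≤Y =
  0≤i+j (0≤i+j (0≤i+j (coeff-nonNeg 5 1 9 1) (0≤i*j 0≤p (coeff-nonNeg 17 4 15 2)))
               (0≤i*j 0≤B (coeff-nonNeg 23 5 24 3)))
        (0≤i*j (0≤i*j 0≤B 0≤p) (coeff-nonNeg 9 2 8 1))
  where
  coeff-nonNeg : ∀ k l m n → 0ℤ ≤ multiaffine k l m n q Y
  coeff-nonNeg k l m n = multiaffine-nonNeg k l m n 0≤q 0≤Y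

lhs≡rhs+excess : ∀ a b x y →
  (+ 2 * a + (b - + 2) * (a + + 2)) * (+ 3 * (x - a + + 3) + (y - b - + 2) * (x - a + + 5))
    ≡ + 3 * (x + + 1) + (y - + 3) * (x + + 3) + excess (a - + 1) (x - (a + + 3)) (b - + 2) (y - (+ 1 + b))
lhs≡rhs+excess = solve-∀

proposition3p6 : (a b x y : ℤ) → + 0 < a → + 0 < b → + 0 < x → + 0 < y
    → a ≡ℤ + 2 mod4 → x ≡ℤ + 1 mod4
    → b < y → + 2 ≤ b
    → a + + 3 ≤ x
    → (+ 2 * a + (b - + 2) * (a + + 2)) * (+ 3 * (x - a + + 3) + (y - b - + 2) * (x - a + + 5))
    ≥ + 3 * (x + + 1) + (y - + 3) * (x + + 3)
proposition3p6 a b x y 0<a _ _ _ _ _ b<y 2≤b a+3≤x =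
  ≤-trans (i≤i+j _ _ ⦃ nonNegative 0≤excess ⦄) (≤-reflexive (sym (lhs≡rhs+excess a b x y)))
  where
  0≤excess : 0ℤ ≤ excess (a - + 1) (x - (a + + 3)) (b - + 2) (y - (+ 1 + b))
  0≤excess = excess-nonNeg (i≤j⇒0≤j-i (i<j⇒suc[i]≤j 0<a)) (i≤j⇒0≤j-i a+3≤x)
                           (i≤j⇒0≤j-i 2≤b) (i≤j⇒0≤j-i (i<j⇒suc[i]≤j b<y))
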